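{- Let $m,n$ be positive integers, $e_1,\dots,e_m,f_1,\dots,f_n$ the standard basis of $\mathbb R^{m+n}$, and $\Delta(m,n)=\{(i|j):=e_i-f_j: 1\le i\le m,\ 1\le j\le n\}$. Call $S\subseteq\Delta(m,n)$ complete if $\mathrm{span}(S)\cap\Delta(m,n)=S$. For $A\subseteq\{1,\dots,m\}$, $B\subseteq\{1,\dots,n\}$ write $A\times B=\{(i|j):i\in A,j\in B\}$ and let $C(A),C(B)$ denote the complements of $A$ in $\{1,\dots,m\}$ and of $B$ in $\{1,\dots,n\}$. Then every maximal proper complete subset $S$ of $\Delta(m,n)$ is of one of the following types: (i) $A\times B\cup C(A)\times C(B)$ with $A,B$ nonempty proper subsets; (ii) $A\times\{1,\dots,n\}$ with $|A|=m-1$; (iii) $\{1,\dots,m\}\times B$ with $|B|=n-1$. -}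

module Defs where

open import Data.Nat using (ℕ; zero; suc)
import Data.Nat as ℕ
open import Data.Fin using (Fin; zero; suc; splitAt; _≟_)
open import Data.Bool using (Bool; true; false; if_then_else_; _∧_; _∨_; not)
open import Data.Sum using (_⊎_; inj₁; inj₂)
open import Data.Product using (Σ; _×_; _,_; ∃)
open import Data.Rational using (ℚ; 0ℚ; 1ℚ; _+_; _*_; -_)
open import Relation.Binary.PropositionalEquality using (_≡_)
open import Relation.Nullary.Decidable using (⌊_⌋)

-- A subset of a finite index set, given by its characteristic function.
-- Subsets of Δ(m,n) are identified with subsets of Fin m × Fin n via the
-- injective map (i , j) ↦ (i|j) = e_i - f_j.
SubsetΔ : ℕ → ℕ → Set
SubsetΔ m n = Fin m → Fin n → Bool

δ : ∀ {k} → Fin k → Fin k → ℚ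
δ a b = if ⌊ a ≟ b ⌋ then 1ℚ else 0ℚ

-- The vector (i|j) = e_i - f_j in ℚ^(m+n); coordinates 0..m-1 are the e's,
-- coordinates m..m+n-1 are the f's.
root : ∀ {m n} → Fin m → Fin n → (Fin (m ℕ.+ n) → ℚ)
root {m} i j k with splitAt m k
... | inj₁ a = δ i a
... | inj₂ b = - δ j b

sumFin : ∀ {k} → (Fin k → ℚ) → ℚ
sumFin {zero}  f = 0ℚ
sumFin {suc k} f = f zero + sumFin (λ x → f (suc x))

InSpan : ∀ {m n} → SubsetΔ m n → (Fin (m ℕ.+ n) → ℚ) → Set
InSpan {m} {n} S v =
  Σ (Fin m → Fin n → ℚ) λ c →
    (∀ i j → S i j ≡ false → c i j ≡ 0ℚ) ×
    (∀ k → sumFin (λ i → sumFin (λ j → c i j * root i j k)) ≡ v k)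

-- S is complete: span(S) ∩ Δ(m,n) = S  (the inclusion S ⊆ span(S) ∩ Δ is automatic).
Complete : ∀ {m n} → SubsetΔ m n → Set
Complete S = ∀ i j → InSpan S (root i j) → S i j ≡ true

_⊆_ : ∀ {m n} → SubsetΔ m n → SubsetΔ m n → Set
S ⊆ T = ∀ i j → S i j ≡ true → T i j ≡ true

Proper : ∀ {m n} → SubsetΔ m n → Set
Proper {m} {n} S = Σ (Fin m) λ i → Σ (Fin n) λ j → S i j ≡ false

MaximalProperComplete : ∀ {m n} → SubsetΔ m n → Set
MaximalProperComplete S =
  Complete S × Proper S × (∀ T → Complete T → Proper T → S ⊆ T → T ⊆ S)

card : ∀ {k} → (Fin k → Bool) → ℕ
card {zero}  A = 0
card {suc k} A = (if A zero then 1 else 0) ℕ.+ card (λ x → A (suc x))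

NonemptyProper : ∀ {k} → (Fin k → Bool) → Set
NonemptyProper {k} A = (∃ λ a → A a ≡ true) × (∃ λ a → A a ≡ false)

TypeI : ∀ {m n} → SubsetΔ m n → Set
TypeI {m} {n} S = Σ (Fin m → Bool) λ A → Σ (Fin n → Bool) λ B →
  NonemptyProper A × NonemptyProper B ×
  (∀ i j → S i j ≡ ((A i ∧ B j) ∨ (not (A i) ∧ not (B j))))

TypeII : ∀ {m n} → SubsetΔ m n → Set
TypeII {m} {n} S = Σ (Fin m → Bool) λ A →
  card A ≡ m ℕ.∸ 1 × (∀ i j → S i j ≡ A i)

TypeIII : ∀ {m n} → SubsetΔ m n → Set
TypeIII {m} {n} S = Σ (Fin n → Bool) λ B →
  card B ≡ n ℕ.∸ 1 × (∀ i j → S i j ≡ B j)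

-- If (i|j), (i′|j), (i′|j′) ∈ S, then
-- (i|j′) = (i|j) − (i′|j) + (i′|j′) ∈ S; hence two rows of a complete set that meet coincide.
-- Conversely, every A × B ∪ C(A) × C(B) is complete: the linear functional that is 1 on e_a
-- (a ∈ A) and on f_b (b ∈ B) and 0 on the other basis vectors takes the value [i ∈ A] − [j ∈ B]
-- at (i|j), so it vanishes on the span of that set and at no other root.
-- Let S be maximal proper complete with (i₀|j₀) ∉ S, let A be the set of rows equal to row i₀
-- and B the row i₀ itself.  As rows that meet coincide, S ⊆ A × B ∪ C(A) × C(B), which is proper
-- and complete, so S equals it.  If A ≠ [m] and B ≠ ∅ this is type (i).  Otherwise S is a product
-- R × [n] or [m] × C, and maximality against ([m] ∖ {i₀}) × [n], resp. [m] × ([n] ∖ {j₀}), shows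
-- that R, resp. C, misses exactly one index.

module Submission where

open import Defs
open import Algebra.Bundles using (CommutativeMonoid; CommutativeRing)
open import Data.Bool using (Bool; true; false; not; _∧_; _∨_; if_then_else_)
import Data.Bool as Bool
open import Data.Bool.Properties using (¬-not)
open import Data.Fin using (Fin; zero; suc; _↑ˡ_; _↑ʳ_; _≟_; splitAt; punchIn)
open import Data.Fin.Properties using (splitAt-↑ˡ; splitAt-↑ʳ; punchInᵢ≢i; suc-injective; all?; any?)
open import Data.Nat using (ℕ; zero; suc; _∸_; _≤_)
import Data.Nat as ℕ
open import Data.Product using (Σ; ∃; _×_; _,_; proj₁)
open import Data.Rational using (ℚ; 0ℚ; 1ℚ; _+_; _*_; -_; _-_)
import Data.Rational.Properties as ℚ
open import Data.Rational.Solver using (module +-*-Solver)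
open import Data.Sum using (_⊎_; inj₁; inj₂)
open import Data.Vec.Functional using (Vector; _++_)
open import Data.Vec.Functional.Properties using (lookup-++ˡ; lookup-++ʳ)
open import Function using (_∘_)
open import Relation.Nullary using (Dec; yes; no; does; contradiction)
open import Relation.Nullary.Decidable using (⌊_⌋; dec-true)
open import Relation.Binary.PropositionalEquality
  using (_≡_; _≢_; refl; sym; trans; cong; cong₂; ≡-≟-identity; ≢-≟-identity; module ≡-Reasoning)
import Relation.Binary.Reasoning.Setoid as SetoidReasoning

module CommutativeMonoidSum {c ℓ} (M : CommutativeMonoid c ℓ) where
  open CommutativeMonoid M
    using (Carrier; _≈_; setoid; ∙-congˡ; identityˡ; identityʳ; assoc)
    renaming (_∙_ to _⊕_; ε to 0#; sym to ≈-sym; trans to ≈-trans)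
  open import Algebra.Properties.CommutativeMonoid.Sum M
    using (sum; sum-cong-≋; sum-replicate-zero; sum-remove)

  sum-zero : ∀ {k} (f : Vector Carrier k) → (∀ x → f x ≈ 0#) → sum f ≈ 0#
  sum-zero {k} f f≈0 = ≈-trans (sum-cong-≋ f≈0) (sum-replicate-zero k)

  sum-single : ∀ {k} (i : Fin k) (f : Vector Carrier k) →
               (∀ x → x ≢ i → f x ≈ 0#) → sum f ≈ f i
  sum-single {suc k} i f f≈0 = begin
    sum f                              ≈⟨ sum-remove {i = i} f ⟩
    f i ⊕ sum (f ∘ punchIn i)          ≈⟨ ∙-congˡ (sum-zero _ (λ x → f≈0 _ (punchInᵢ≢i i x))) ⟩
    f i ⊕ 0#                           ≈⟨ identityʳ (f i) ⟩
    f i                                ∎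
    where open SetoidReasoning setoid

  sum-split : ∀ m {n} (f : Vector Carrier (m ℕ.+ n)) →
              sum f ≈ sum (f ∘ (_↑ˡ n)) ⊕ sum (f ∘ (m ↑ʳ_))
  sum-split zero    f = ≈-sym (identityˡ (sum f))
  sum-split (suc m) f = ≈-trans (∙-congˡ (sum-split m (f ∘ suc))) (≈-sym (assoc _ _ _))

open CommutativeMonoidSum ℚ.+-0-commutativeMonoid using (sum-zero; sum-single; sum-split)
open import Algebra.Properties.Semiring.Sum (CommutativeRing.semiring ℚ.+-*-commutativeRing)
  using (sum; sum-syntax; sum-cong-≗; ∑-distrib-+; ∑-comm; *-distribˡ-sum)

sumFin≡sum : ∀ {k} (f : Vector ℚ k) → sumFin f ≡ sum f
sumFin≡sum {zero}  f = refl
sumFin≡sum {suc k} f = cong (f zero +_) (sumFin≡sum (f ∘ suc))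

≟-refl : ∀ {k} (a : Fin k) → ⌊ a ≟ a ⌋ ≡ true
≟-refl a = cong ⌊_⌋ (≡-≟-identity _≟_ refl)

≟-≢ : ∀ {k} {a b : Fin k} → a ≢ b → ⌊ a ≟ b ⌋ ≡ false
≟-≢ a≢b = cong ⌊_⌋ (≢-≟-identity _≟_ a≢b)

δ-refl : ∀ {k} (a : Fin k) → δ a a ≡ 1ℚ
δ-refl a = cong (λ b → if b then 1ℚ else 0ℚ) (≟-refl a)

δ-≢ : ∀ {k} {a b : Fin k} → a ≢ b → δ a b ≡ 0ℚ
δ-≢ a≢b = cong (λ b → if b then 1ℚ else 0ℚ) (≟-≢ a≢b)

module _ {m n : ℕ} (i : Fin m) (j : Fin n) where

  root-↑ˡ : ∀ a → root i j (a ↑ˡ n) ≡ δ i a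
  root-↑ˡ a rewrite splitAt-↑ˡ m a n = refl

  root-↑ʳ : ∀ b → root i j (m ↑ʳ b) ≡ - δ j b
  root-↑ʳ b rewrite splitAt-↑ʳ m n b = refl

root-exchange : ∀ {m n} (i i′ : Fin m) (j j′ : Fin n) k →
                root i j k + (- 1ℚ * root i′ j k + root i′ j′ k) ≡ root i j′ k
root-exchange {m} i i′ j j′ k with splitAt m k
... | inj₁ a = solve 2 (λ x y → x :+ (:- con 1ℚ :* y :+ y) := x) refl (δ i a) (δ i′ a)
  where open +-*-Solver
... | inj₂ b = solve 2 (λ x y → :- x :+ (:- con 1ℚ :* :- x :+ :- y) := :- y) refl (δ j b) (δ j′ b)
  where open +-*-Solver

⟨_,_⟩ : ∀ {K} → Vector ℚ K → Vector ℚ K → ℚ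
⟨_,_⟩ {K} w v = ∑[ k < K ] (w k * v k)

⟨,root⟩ : ∀ {m n} (w : Vector ℚ (m ℕ.+ n)) (i : Fin m) (j : Fin n) →
          ⟨ w , root i j ⟩ ≡ w (i ↑ˡ n) - w (m ↑ʳ j)
⟨,root⟩ {m} {n} w i j = begin
  ⟨ w , root i j ⟩
    ≡⟨ sum-split m _ ⟩
  sum (λ a → w (a ↑ˡ n) * root i j (a ↑ˡ n)) + sum (λ b → w (m ↑ʳ b) * root i j (m ↑ʳ b))
    ≡⟨ cong₂ _+_ (sum-single i _ off-iˡ) (sum-single j _ off-jʳ) ⟩
  w (i ↑ˡ n) * root i j (i ↑ˡ n) + w (m ↑ʳ j) * root i j (m ↑ʳ j)
    ≡⟨ cong₂ (λ x y → w (i ↑ˡ n) * x + w (m ↑ʳ j) * y)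
             (trans (root-↑ˡ i j i) (δ-refl i)) (trans (root-↑ʳ i j j) (cong -_ (δ-refl j))) ⟩
  w (i ↑ˡ n) * 1ℚ + w (m ↑ʳ j) * - 1ℚ
    ≡⟨ solve 2 (λ x y → x :* con 1ℚ :+ y :* :- con 1ℚ := x :- y) refl (w (i ↑ˡ n)) (w (m ↑ʳ j)) ⟩
  w (i ↑ˡ n) - w (m ↑ʳ j) ∎
  where
  open ≡-Reasoning
  open +-*-Solver
  off-iˡ : ∀ a → a ≢ i → w (a ↑ˡ n) * root i j (a ↑ˡ n) ≡ 0ℚ
  off-iˡ a a≢i = trans (cong (w (a ↑ˡ n) *_) (trans (root-↑ˡ i j a) (δ-≢ (a≢i ∘ sym))))
                       (ℚ.*-zeroʳ (w (a ↑ˡ n)))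
  off-jʳ : ∀ b → b ≢ j → w (m ↑ʳ b) * root i j (m ↑ʳ b) ≡ 0ℚ
  off-jʳ b b≢j = trans (cong (w (m ↑ʳ b) *_) (trans (root-↑ʳ i j b) (cong -_ (δ-≢ (b≢j ∘ sym)))))
                       (ℚ.*-zeroʳ (w (m ↑ʳ b)))

combination : ∀ {m n} → (Fin m → Fin n → ℚ) → Vector ℚ (m ℕ.+ n)
combination {m} {n} c k = ∑[ a < m ] ∑[ b < n ] (c a b * root a b k)

sumFin²≡combination : ∀ {m n} (c : Fin m → Fin n → ℚ) k →
                      sumFin (λ a → sumFin (λ b → c a b * root a b k)) ≡ combination c k
sumFin²≡combination c k =
  trans (sumFin≡sum (λ a → sumFin (λ b → c a b * root a b k)))
        (sum-cong-≗ (λ a → sumFin≡sum (λ b → c a b * root a b k)))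

combination-+ : ∀ {m n} (c d : Fin m → Fin n → ℚ) k →
                combination (λ a b → c a b + d a b) k ≡ combination c k + combination d k
combination-+ {m} {n} c d k = begin
  ∑[ a < m ] ∑[ b < n ] ((c a b + d a b) * root a b k)
    ≡⟨ sum-cong-≗ (λ a → sum-cong-≗ (λ b → ℚ.*-distribʳ-+ (root a b k) (c a b) (d a b))) ⟩
  ∑[ a < m ] ∑[ b < n ] (c a b * root a b k + d a b * root a b k)
    ≡⟨ sum-cong-≗ (λ a → ∑-distrib-+ (λ b → c a b * root a b k) (λ b → d a b * root a b k)) ⟩
  ∑[ a < m ] (∑[ b < n ] (c a b * root a b k) + ∑[ b < n ] (d a b * root a b k))
    ≡⟨ ∑-distrib-+ (λ a → ∑[ b < n ] (c a b * root a b k)) (λ a → ∑[ b < n ] (d a b * root a b k)) ⟩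
  combination c k + combination d k ∎
  where open ≡-Reasoning

combination-* : ∀ {m n} (x : ℚ) (c : Fin m → Fin n → ℚ) k →
                combination (λ a b → x * c a b) k ≡ x * combination c k
combination-* {m} {n} x c k = begin
  ∑[ a < m ] ∑[ b < n ] (x * c a b * root a b k)
    ≡⟨ sum-cong-≗ (λ a → sum-cong-≗ (λ b → ℚ.*-assoc x (c a b) (root a b k))) ⟩
  ∑[ a < m ] ∑[ b < n ] (x * (c a b * root a b k))
    ≡⟨ sum-cong-≗ (λ a → sym (*-distribˡ-sum x (λ b → c a b * root a b k))) ⟩
  ∑[ a < m ] (x * ∑[ b < n ] (c a b * root a b k))
    ≡⟨ sym (*-distribˡ-sum x (λ a → ∑[ b < n ] (c a b * root a b k))) ⟩
  x * combination c k ∎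
  where open ≡-Reasoning

basis : ∀ {m n} → Fin m → Fin n → Fin m → Fin n → ℚ
basis i j a b = δ i a * δ j b

combination-basis : ∀ {m n} (i : Fin m) (j : Fin n) k → combination (basis i j) k ≡ root i j k
combination-basis {m} {n} i j k = begin
  ∑[ a < m ] ∑[ b < n ] (basis i j a b * root a b k)
    ≡⟨ sum-single i _ (λ a a≢i → sum-zero _ (λ b → off-i a a≢i b)) ⟩
  ∑[ b < n ] (basis i j i b * root i b k)
    ≡⟨ sum-single j _ off-j ⟩
  (δ i i * δ j j) * root i j k
    ≡⟨ cong₂ (λ x y → (x * y) * root i j k) (δ-refl i) (δ-refl j) ⟩
  1ℚ * 1ℚ * root i j k
    ≡⟨ ℚ.*-identityˡ (root i j k) ⟩
  root i j k ∎
  where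
  open ≡-Reasoning
  off-i : ∀ a → a ≢ i → ∀ b → basis i j a b * root a b k ≡ 0ℚ
  off-i a a≢i b = begin
    δ i a * δ j b * root a b k ≡⟨ cong (λ x → x * δ j b * root a b k) (δ-≢ (a≢i ∘ sym)) ⟩
    0ℚ * δ j b * root a b k    ≡⟨ cong (_* root a b k) (ℚ.*-zeroˡ (δ j b)) ⟩
    0ℚ * root a b k            ≡⟨ ℚ.*-zeroˡ (root a b k) ⟩
    0ℚ                         ∎
  off-j : ∀ b → b ≢ j → basis i j i b * root i b k ≡ 0ℚ
  off-j b b≢j = begin
    δ i i * δ j b * root i b k ≡⟨ cong (λ x → δ i i * x * root i b k) (δ-≢ (b≢j ∘ sym)) ⟩
    δ i i * 0ℚ * root i b k    ≡⟨ cong (_* root i b k) (ℚ.*-zeroʳ (δ i i)) ⟩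
    0ℚ * root i b k            ≡⟨ ℚ.*-zeroˡ (root i b k) ⟩
    0ℚ                         ∎

⟨,combination⟩ : ∀ {m n} (w : Vector ℚ (m ℕ.+ n)) (c : Fin m → Fin n → ℚ) →
                 ⟨ w , combination c ⟩ ≡ ∑[ a < m ] ∑[ b < n ] (c a b * ⟨ w , root a b ⟩)
⟨,combination⟩ {m} {n} w c = begin
  ∑[ k < K ] (w k * ∑[ a < m ] ∑[ b < n ] (c a b * root a b k))
    ≡⟨ sum-cong-≗ (λ k → *-distribˡ-sum (w k) (λ a → ∑[ b < n ] (c a b * root a b k))) ⟩
  ∑[ k < K ] ∑[ a < m ] (w k * ∑[ b < n ] (c a b * root a b k))
    ≡⟨ sum-cong-≗ (λ k → sum-cong-≗ (λ a → *-distribˡ-sum (w k) (λ b → c a b * root a b k))) ⟩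
  ∑[ k < K ] ∑[ a < m ] ∑[ b < n ] (w k * (c a b * root a b k))
    ≡⟨ ∑-comm (λ k a → ∑[ b < n ] (w k * (c a b * root a b k))) ⟩
  ∑[ a < m ] ∑[ k < K ] ∑[ b < n ] (w k * (c a b * root a b k))
    ≡⟨ sum-cong-≗ (λ a → ∑-comm (λ k b → w k * (c a b * root a b k))) ⟩
  ∑[ a < m ] ∑[ b < n ] ∑[ k < K ] (w k * (c a b * root a b k))
    ≡⟨ sum-cong-≗ (λ a → sum-cong-≗ (λ b → sum-cong-≗ (λ k →
         solve 3 (λ x y z → x :* (y :* z) := y :* (x :* z)) refl (w k) (c a b) (root a b k)))) ⟩
  ∑[ a < m ] ∑[ b < n ] ∑[ k < K ] (c a b * (w k * root a b k))
    ≡⟨ sum-cong-≗ (λ a → sum-cong-≗ (λ b → sym (*-distribˡ-sum (c a b) (λ k → w k * root a b k)))) ⟩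
  ∑[ a < m ] ∑[ b < n ] (c a b * ⟨ w , root a b ⟩) ∎
  where
  K = m ℕ.+ n
  open ≡-Reasoning
  open +-*-Solver

module _ {m n : ℕ} {S : SubsetΔ m n} where

  combination-of-InSpan : ∀ {v} (p : InSpan S v) → ∀ k → combination (proj₁ p) k ≡ v k
  combination-of-InSpan (c , _ , c≗v) k = trans (sym (sumFin²≡combination c k)) (c≗v k)

  InSpan-combination : (c : Fin m → Fin n → ℚ) → (∀ a b → S a b ≡ false → c a b ≡ 0ℚ) →
                       InSpan S (combination c)
  InSpan-combination c c-vanishes = c , c-vanishes , sumFin²≡combination c

  InSpan-cong : ∀ {u v} → (∀ k → u k ≡ v k) → InSpan S u → InSpan S v
  InSpan-cong u≗v (c , c-vanishes , c≗u) = c , c-vanishes , λ k → trans (c≗u k) (u≗v k)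

  InSpan-root : ∀ {i j} → S i j ≡ true → InSpan S (root i j)
  InSpan-root {i} {j} Sij =
    InSpan-cong (combination-basis i j) (InSpan-combination (basis i j) basis-vanishes)
    where
    basis-vanishes : ∀ a b → S a b ≡ false → basis i j a b ≡ 0ℚ
    basis-vanishes a b Sab with a ≟ i | b ≟ j
    ... | no a≢i   | _        = trans (cong (_* δ j b) (δ-≢ (a≢i ∘ sym))) (ℚ.*-zeroˡ (δ j b))
    ... | yes _    | no b≢j   = trans (cong (δ i a *_) (δ-≢ (b≢j ∘ sym))) (ℚ.*-zeroʳ (δ i a))
    ... | yes refl | yes refl = contradiction (trans (sym Sij) Sab) λ ()

  InSpan-+ : ∀ {u v} → InSpan S u → InSpan S v → InSpan S (λ k → u k + v k)
  InSpan-+ p@(c , c-vanishes , _) q@(d , d-vanishes , _) =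
    InSpan-cong (λ k → trans (combination-+ c d k)
                             (cong₂ _+_ (combination-of-InSpan p k) (combination-of-InSpan q k)))
                (InSpan-combination (λ a b → c a b + d a b)
                                    (λ a b Sab → cong₂ _+_ (c-vanishes a b Sab) (d-vanishes a b Sab)))

  InSpan-* : ∀ {v} (x : ℚ) → InSpan S v → InSpan S (λ k → x * v k)
  InSpan-* x p@(c , c-vanishes , _) =
    InSpan-cong (λ k → trans (combination-* x c k) (cong (x *_) (combination-of-InSpan p k)))
                (InSpan-combination (λ a b → x * c a b)
                                    (λ a b Sab → trans (cong (x *_) (c-vanishes a b Sab)) (ℚ.*-zeroʳ x)))

  ⟨,⟩-vanishes-on-span : ∀ {v} (w : Vector ℚ (m ℕ.+ n)) →
                         (∀ a b → S a b ≡ true → ⟨ w , root a b ⟩ ≡ 0ℚ) →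
                         InSpan S v → ⟨ w , v ⟩ ≡ 0ℚ
  ⟨,⟩-vanishes-on-span {v} w w⊥S p@(c , c-vanishes , _) = begin
    ⟨ w , v ⟩
      ≡⟨ sum-cong-≗ (λ k → cong (w k *_) (sym (combination-of-InSpan p k))) ⟩
    ⟨ w , combination c ⟩
      ≡⟨ ⟨,combination⟩ w c ⟩
    ∑[ a < m ] ∑[ b < n ] (c a b * ⟨ w , root a b ⟩)
      ≡⟨ sum-zero _ (λ a → sum-zero _ (term-vanishes a)) ⟩
    0ℚ ∎
    where
    open ≡-Reasoning
    term-vanishes : ∀ a b → c a b * ⟨ w , root a b ⟩ ≡ 0ℚ
    term-vanishes a b with S a b in Sab
    ... | true  = trans (cong (c a b *_) (w⊥S a b Sab)) (ℚ.*-zeroʳ (c a b))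
    ... | false = trans (cong (_* ⟨ w , root a b ⟩) (c-vanishes a b Sab)) (ℚ.*-zeroˡ ⟨ w , root a b ⟩)

  complete-exchange : Complete S → ∀ {i i′ j j′} →
                      S i j ≡ true → S i′ j ≡ true → S i′ j′ ≡ true → S i j′ ≡ true
  complete-exchange complete {i} {i′} {j} {j′} Sij Si′j Si′j′ =
    complete i j′ (InSpan-cong (root-exchange i i′ j j′)
      (InSpan-+ (InSpan-root Sij) (InSpan-+ (InSpan-* (- 1ℚ) (InSpan-root Si′j)) (InSpan-root Si′j′))))

true⇔⇒≡ : ∀ {x y} → (x ≡ true → y ≡ true) → (y ≡ true → x ≡ true) → x ≡ y
true⇔⇒≡ {true}  x⇒y _   = sym (x⇒y refl)
true⇔⇒≡ {false} {true}  _ y⇒x = y⇒x refl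
true⇔⇒≡ {false} {false} _ _   = refl

complete-rows-meet⇒≡ : ∀ {m n} {S : SubsetΔ m n} → Complete S → ∀ {i i′ j} →
                       S i j ≡ true → S i′ j ≡ true → ∀ j′ → S i j′ ≡ S i′ j′
complete-rows-meet⇒≡ complete Sij Si′j j′ =
  true⇔⇒≡ (complete-exchange complete Si′j Sij) (complete-exchange complete Sij Si′j)

agree : Bool → Bool → Bool
agree x y = (x ∧ y) ∨ (not x ∧ not y)

≡⇒agree : ∀ {x y} → x ≡ y → agree x y ≡ true
≡⇒agree {true}  refl = refl
≡⇒agree {false} refl = refl

agree⇒≡ : ∀ x y → agree x y ≡ true → x ≡ y
agree⇒≡ true  true  _ = refl
agree⇒≡ false false _ = refl

agree-trueˡ : ∀ y → agree true y ≡ y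
agree-trueˡ true  = refl
agree-trueˡ false = refl

agree-falseʳ : ∀ x → agree x false ≡ not x
agree-falseʳ true  = refl
agree-falseʳ false = refl

blockDiagonal : ∀ {m n} → (Fin m → Bool) → (Fin n → Bool) → SubsetΔ m n
blockDiagonal A B i j = agree (A i) (B j)

indicator : Bool → ℚ
indicator true  = 1ℚ
indicator false = 0ℚ

indicator-diff≡0⇒≡ : ∀ x y → indicator x - indicator y ≡ 0ℚ → x ≡ y
indicator-diff≡0⇒≡ true  true  _ = refl
indicator-diff≡0⇒≡ false false _ = refl

blockDiagonal-complete : ∀ {m n} (A : Fin m → Bool) (B : Fin n → Bool) → Complete (blockDiagonal A B)
blockDiagonal-complete {m} {n} A B i j inSpan =
  ≡⇒agree (indicator-diff≡0⇒≡ (A i) (B j)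
    (trans (sym (⟨w,root⟩ i j)) (⟨,⟩-vanishes-on-span w w⊥blockDiagonal inSpan)))
  where
  w : Vector ℚ (m ℕ.+ n)
  w = (indicator ∘ A) ++ (indicator ∘ B)
  ⟨w,root⟩ : ∀ a b → ⟨ w , root a b ⟩ ≡ indicator (A a) - indicator (B b)
  ⟨w,root⟩ a b = trans (⟨,root⟩ w a b)
    (cong₂ _-_ (lookup-++ˡ (indicator ∘ A) (indicator ∘ B) a)
               (lookup-++ʳ (indicator ∘ A) (indicator ∘ B) b))
  w⊥blockDiagonal : ∀ a b → blockDiagonal A B a b ≡ true → ⟨ w , root a b ⟩ ≡ 0ℚ
  w⊥blockDiagonal a b agreeing = begin
    ⟨ w , root a b ⟩                  ≡⟨ ⟨w,root⟩ a b ⟩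
    indicator (A a) - indicator (B b) ≡⟨ cong (λ y → indicator (A a) - indicator y)
                                              (sym (agree⇒≡ (A a) (B b) agreeing)) ⟩
    indicator (A a) - indicator (A a) ≡⟨ ℚ.+-inverseʳ (indicator (A a)) ⟩
    0ℚ                                ∎
    where open ≡-Reasoning

card-all : ∀ {k} (f : Fin k → Bool) → (∀ x → f x ≡ true) → card f ≡ k
card-all {zero}  f _ = refl
card-all {suc k} f f-true rewrite f-true zero = cong suc (card-all (f ∘ suc) (f-true ∘ suc))

card-allButOne : ∀ {k} (i : Fin k) (f : Fin k → Bool) →
                 f i ≡ false → (∀ x → x ≢ i → f x ≡ true) → card f ≡ k ∸ 1
card-allButOne zero f f-i f-true rewrite f-i = card-all (f ∘ suc) (λ x → f-true (suc x) λ ())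
card-allButOne {suc (suc k)} (suc i) f f-i f-true rewrite f-true zero (λ ()) =
  cong suc (card-allButOne i (f ∘ suc) f-i (λ x x≢i → f-true (suc x) (x≢i ∘ suc-injective)))

_≐_ : ∀ {m n} → SubsetΔ m n → SubsetΔ m n → Set
S ≐ T = ∀ i j → S i j ≡ T i j

maximal-⊆⇒≐ : ∀ {m n} {S T : SubsetΔ m n} → MaximalProperComplete S →
              Complete T → Proper T → S ⊆ T → S ≐ T
maximal-⊆⇒≐ (_ , _ , maximal) T-complete T-proper S⊆T i j =
  true⇔⇒≡ (S⊆T i j) (maximal _ T-complete T-proper S⊆T i j)

maximal⇒blockDiagonal : ∀ {m n} {S : SubsetΔ m n} {i₀ j₀} →
                        MaximalProperComplete S → S i₀ j₀ ≡ false →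
                        Σ (Fin m → Bool) λ A → Σ (Fin n → Bool) λ B →
                          A i₀ ≡ true × B j₀ ≡ false × S ≐ blockDiagonal A B
maximal⇒blockDiagonal {m} {S = S} {i₀} {j₀} maximal@(complete , _ , _) S-i₀j₀ =
  sameRow , S i₀ , sameRow-i₀ , S-i₀j₀ ,
  maximal-⊆⇒≐ maximal (blockDiagonal-complete sameRow (S i₀))
                      (i₀ , j₀ , cong₂ agree sameRow-i₀ S-i₀j₀) S⊆T
  where
  sameRow? : ∀ i → Dec (∀ j → S i j ≡ S i₀ j)
  sameRow? i = all? (λ j → S i j Bool.≟ S i₀ j)
  sameRow : Fin m → Bool
  sameRow i = does (sameRow? i)
  sameRow-i₀ : sameRow i₀ ≡ true
  sameRow-i₀ = dec-true (sameRow? i₀) (λ _ → refl)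
  S⊆T : ∀ i j → S i j ≡ true → agree (does (sameRow? i)) (S i₀ j) ≡ true
  S⊆T i j Sij = by-cases (sameRow? i)
    where
    by-cases : (d : Dec (∀ j′ → S i j′ ≡ S i₀ j′)) → agree (does d) (S i₀ j) ≡ true
    by-cases (yes rows≡) = trans (agree-trueˡ (S i₀ j)) (trans (sym (rows≡ j)) Sij)
    by-cases (no rows≢)  =
      cong (agree false) (¬-not (λ S-i₀j → rows≢ (complete-rows-meet⇒≡ complete Sij S-i₀j)))

maximal-rowProduct⇒TypeII : ∀ {m n} {S : SubsetΔ m n} (R : Fin m → Bool) →
                            MaximalProperComplete S → (∀ i j → S i j ≡ R i) → TypeII S
maximal-rowProduct⇒TypeII {m} {n} {S} R maximal@(_ , (i₀ , j₀ , S-i₀j₀) , _) S≐R =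
  R , card-allButOne i₀ R R-i₀ R-true , S≐R
  where
  R-i₀ : R i₀ ≡ false
  R-i₀ = trans (sym (S≐R i₀ j₀)) S-i₀j₀
  T : SubsetΔ m n
  T = blockDiagonal (λ i → ⌊ i ≟ i₀ ⌋) (λ _ → false)
  S⊆T : S ⊆ T
  S⊆T i j Sij = trans (agree-falseʳ ⌊ i ≟ i₀ ⌋) (cong not (≟-≢ i≢i₀))
    where
    i≢i₀ : i ≢ i₀
    i≢i₀ refl = contradiction (trans (sym Sij) (trans (S≐R i₀ j) R-i₀)) λ ()
  S≐T : S ≐ T
  S≐T = maximal-⊆⇒≐ maximal (blockDiagonal-complete (λ i → ⌊ i ≟ i₀ ⌋) (λ _ → false))
                            (i₀ , j₀ , cong (λ x → agree x false) (≟-refl i₀)) S⊆T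
  R-true : ∀ i → i ≢ i₀ → R i ≡ true
  R-true i i≢i₀ = begin
    R i                     ≡⟨ sym (S≐R i j₀) ⟩
    S i j₀                  ≡⟨ S≐T i j₀ ⟩
    agree ⌊ i ≟ i₀ ⌋ false  ≡⟨ agree-falseʳ ⌊ i ≟ i₀ ⌋ ⟩
    not ⌊ i ≟ i₀ ⌋          ≡⟨ cong not (≟-≢ i≢i₀) ⟩
    true                    ∎
    where open ≡-Reasoning

maximal-columnProduct⇒TypeIII : ∀ {m n} {S : SubsetΔ m n} (C : Fin n → Bool) →
                               MaximalProperComplete S → (∀ i j → S i j ≡ C j) → TypeIII S
maximal-columnProduct⇒TypeIII {m} {n} {S} C maximal@(_ , (i₀ , j₀ , S-i₀j₀) , _) S≐C =
  C , card-allButOne j₀ C C-j₀ C-true , S≐C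
  where
  C-j₀ : C j₀ ≡ false
  C-j₀ = trans (sym (S≐C i₀ j₀)) S-i₀j₀
  T : SubsetΔ m n
  T = blockDiagonal (λ _ → true) (λ j → not ⌊ j ≟ j₀ ⌋)
  S⊆T : S ⊆ T
  S⊆T i j Sij = trans (agree-trueˡ (not ⌊ j ≟ j₀ ⌋)) (cong not (≟-≢ j≢j₀))
    where
    j≢j₀ : j ≢ j₀
    j≢j₀ refl = contradiction (trans (sym Sij) (trans (S≐C i j₀) C-j₀)) λ ()
  S≐T : S ≐ T
  S≐T = maximal-⊆⇒≐ maximal (blockDiagonal-complete (λ _ → true) (λ j → not ⌊ j ≟ j₀ ⌋))
                            (i₀ , j₀ , cong (agree true ∘ not) (≟-refl j₀)) S⊆T
  C-true : ∀ j → j ≢ j₀ → C j ≡ true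
  C-true j j≢j₀ = begin
    C j                          ≡⟨ sym (S≐C i₀ j) ⟩
    S i₀ j                       ≡⟨ S≐T i₀ j ⟩
    agree true (not ⌊ j ≟ j₀ ⌋)  ≡⟨ agree-trueˡ (not ⌊ j ≟ j₀ ⌋) ⟩
    not ⌊ j ≟ j₀ ⌋               ≡⟨ cong not (≟-≢ j≢j₀) ⟩
    true                         ∎
    where open ≡-Reasoning

maximal-blockDiagonal-types : ∀ {m n} {S : SubsetΔ m n} (A : Fin m → Bool) (B : Fin n → Bool) →
                              ∀ {i₀ j₀} → MaximalProperComplete S → A i₀ ≡ true → B j₀ ≡ false →
                              S ≐ blockDiagonal A B → TypeI S ⊎ TypeII S ⊎ TypeIII S
maximal-blockDiagonal-types {S = S} A B {i₀} {j₀} maximal A-i₀ B-j₀ S≐AB =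
  by-cases (any? (λ i → A i Bool.≟ false)) (any? (λ j → B j Bool.≟ true))
  where
  by-cases : Dec (∃ λ i → A i ≡ false) → Dec (∃ λ j → B j ≡ true) →
             TypeI S ⊎ TypeII S ⊎ TypeIII S
  by-cases (yes A-false) (yes B-true) =
    inj₁ (A , B , ((i₀ , A-i₀) , A-false) , (B-true , (j₀ , B-j₀)) , S≐AB)
  by-cases (yes _) (no ¬B-true) = inj₂ (inj₁ (maximal-rowProduct⇒TypeII (not ∘ A) maximal S≐¬A))
    where
    S≐¬A : ∀ i j → S i j ≡ not (A i)
    S≐¬A i j = trans (S≐AB i j)
      (trans (cong (agree (A i)) (¬-not (λ Bj → ¬B-true (j , Bj)))) (agree-falseʳ (A i)))
  by-cases (no ¬A-false) _ = inj₂ (inj₂ (maximal-columnProduct⇒TypeIII B maximal S≐B))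
    where
    S≐B : ∀ i j → S i j ≡ B j
    S≐B i j = trans (S≐AB i j)
      (trans (cong (λ x → agree x (B j)) (¬-not (λ Ai → ¬A-false (i , Ai)))) (agree-trueˡ (B j)))

-- The hypotheses 1 ≤ m and 1 ≤ n are implied by properness.
mainTheorem11 : (m n : ℕ) → 1 ≤ m → 1 ≤ n → (S : SubsetΔ m n) →
    MaximalProperComplete S → TypeI S ⊎ TypeII S ⊎ TypeIII S
mainTheorem11 m n _ _ S maximal@(_ , (i₀ , j₀ , S-i₀j₀) , _) =
  let A , B , A-i₀ , B-j₀ , S≐AB = maximal⇒blockDiagonal maximal S-i₀j₀
  in  maximal-blockDiagonal-types A B maximal A-i₀ B-j₀ S≐AB
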